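{- Let $c\ge 2$ be an integer and suppose the graph $G$ has an induced chain $P$ with $4c$ vertices. Then $G$ has an induced chain with $c$ vertices whose binary representation either consists only of $0$s, or consists only of $1$s, or ends with one of $001$, $011$, $0101$.
   Context: A chain in a graph $G$ is a sequence of distinct vertices $v_1,\dots,v_c$ such that for each $i\in\{2,\dots,c\}$, $v_i$ is either of type $0$ (adjacent to every vertex among $v_1,\dots,v_{i-2}$ and not adjacent to $v_{i-1}$) or of type $1$ (adjacent to $v_{i-1}$ and non-adjacent to all of $v_1,\dots,v_{i-2}$); $v_1$ is assigned a type arbitrarily. Its binary representation is the string whose $i$-th character is the type of $v_i$. For $1\le i\le j\le c$, the consecutive vertices $v_i,\dots,v_j$ again form a chain, with binary representation the corresponding substring. -}

module Defs where

open import Data.Nat using (ℕ; suc; _+_; _<_)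
open import Data.Fin using (Fin; toℕ)
open import Data.Bool using (Bool; true; false)
open import Data.List using (List; _++_)
open import Data.Product using (_×_; ∃)
open import Relation.Binary.PropositionalEquality using (_≡_)
open import Function.Definitions using (Injective)
open import Data.Vec.Functional using (toList)

record Graph (n : ℕ) : Set where
  field
    adj     : Fin n → Fin n → Bool
    adj-sym : ∀ x y → adj x y ≡ adj y x
    irrefl  : ∀ x → adj x x ≡ false
open Graph public

-- Types: type 0 = false, type 1 = true.
-- A chain of length c: distinct vertices v : Fin c → Fin n together with
-- types t : Fin c → Bool (t of the first vertex arbitrary) such that for
-- every i ≥ 1 (0-indexed):
--   t i = 0 : v i non-adjacent to v (i-1), adjacent to all v j with j < i-1;
--   t i = 1 : v i adjacent to v (i-1), non-adjacent to all v j with j < i-1.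
record IsChain {n : ℕ} (G : Graph n) (c : ℕ)
               (v : Fin c → Fin n) (t : Fin c → Bool) : Set where
  field
    distinct : Injective _≡_ _≡_ v
    previous : ∀ (i j : Fin c) → suc (toℕ j) ≡ toℕ i →
               (t i ≡ false → adj G (v j) (v i) ≡ false) ×
               (t i ≡ true  → adj G (v j) (v i) ≡ true)
    earlier  : ∀ (i j : Fin c) → suc (toℕ j) < toℕ i →
               (t i ≡ false → adj G (v j) (v i) ≡ true) ×
               (t i ≡ true  → adj G (v j) (v i) ≡ false)

binRep : {c : ℕ} → (Fin c → Bool) → List Bool
binRep t = toList t

EndsWith : List Bool → List Bool → Set
EndsWith xs s = ∃ λ p → xs ≡ p ++ s

AllEq : {c : ℕ} → Bool → (Fin c → Bool) → Set
AllEq b t = ∀ i → t i ≡ b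

{-# OPTIONS --safe #-}

-- Consecutive vertices of a chain form a chain, and the type of the first of them can be
-- reassigned at will. So, reading the types of P as a binary sequence s, it suffices to find a
-- window of length c among the first 4c letters which, after possibly changing its first
-- letter, is constant or ends in 001, 011 or 0101.
-- For c = 2 and c = 3 take b x x, resp. 0 x 1 or 0 0 z, near the start. For c ≥ 4 every pattern
-- fits and no letter needs changing: if s is constantly 1 on [c, 2c) take that window; otherwise
-- a 0 at some i ∈ [c, 2c) starts 011 or 0101, or there is a pair 00 at i or i + 2, and from a
-- pair 00 the zeros either continue for c letters or run into 001. All these windows end before 4c.

module Submission where

open import Defs
open import Data.Nat using (ℕ; zero; suc; _+_; _*_; _≤_; _<_; z≤n; s≤s; s≤s⁻¹)
open import Data.Nat.Properties
open import Data.Nat.Tactic.RingSolver using (solve-∀)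
open import Data.Fin using (Fin; toℕ; inject≤; _↑ʳ_)
open import Data.Fin.Properties using (toℕ-inject≤; toℕ-↑ʳ; inject≤-injective; ↑ʳ-injective)
open import Data.Bool using (Bool; true; false)
open import Data.List using (List; []; _∷_; _++_; length; tabulate)
open import Data.List.Properties using (∷-injectiveʳ)
open import Data.List.Relation.Unary.All using (All; []; _∷_)
open import Data.List.Relation.Unary.All.Properties using (tabulate⁻)
open import Data.Vec.Functional using (Vector; tail) renaming (_∷_ to _◂_)
open import Data.Product using (Σ; _×_; _,_; ∃; ∃₂)
open import Data.Sum using (_⊎_; inj₁; inj₂)
open import Function using (_∘_)
open import Relation.Binary.PropositionalEquality

shift : ∀ {c N} a → a + c ≤ N → Fin c → Fin N
shift a le i = inject≤ (a ↑ʳ i) le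

toℕ-shift : ∀ {c N} a (le : a + c ≤ N) i → toℕ (shift a le i) ≡ a + toℕ i
toℕ-shift a le i = trans (toℕ-inject≤ (a ↑ʳ i) le) (toℕ-↑ʳ a i)

module _ {n} {G : Graph n} where

  IsChain-window : ∀ {N c v t} → IsChain G N v t → ∀ a (le : a + c ≤ N) →
                   IsChain G c (v ∘ shift a le) (t ∘ shift a le)
  IsChain-window ch a le = record
    { distinct = λ {i} {j} eq →
        ↑ʳ-injective a i j (inject≤-injective le le _ _ (IsChain.distinct ch eq))
    ; previous = λ i j j+1≡i → IsChain.previous ch _ _ (begin
        suc (toℕ (shift a le j)) ≡⟨ cong suc (toℕ-shift a le j) ⟩
        suc (a + toℕ j)          ≡⟨ +-suc a (toℕ j) ⟨
        a + suc (toℕ j)          ≡⟨ cong (a +_) j+1≡i ⟩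
        a + toℕ i                ≡⟨ toℕ-shift a le i ⟨
        toℕ (shift a le i)       ∎)
    ; earlier = λ i j j+1<i → IsChain.earlier ch _ _
        (subst₂ (λ x y → suc x < y) (sym (toℕ-shift a le j)) (sym (toℕ-shift a le i))
          (subst (_< a + toℕ i) (+-suc a (toℕ j)) (+-monoʳ-< a j+1<i)))
    }
    where open ≡-Reasoning

  IsChain-retypeHead : ∀ {c v t} → IsChain G (suc c) v t → ∀ b → IsChain G (suc c) v (b ◂ tail t)
  -- No constraint has the first vertex as its later vertex, so the clauses for it are absurd.
  IsChain-retypeHead ch b = record
    { distinct = IsChain.distinct ch
    ; previous = λ { (Fin.suc i) j eq → IsChain.previous ch (Fin.suc i) j eq }
    ; earlier  = λ { (Fin.suc i) j lt → IsChain.earlier ch (Fin.suc i) j lt }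
    }

window : (ℕ → Bool) → ℕ → ℕ → List Bool
window s a zero    = []
window s a (suc c) = s a ∷ window s (suc a) c

window-++ : ∀ s a m n → window s a (m + n) ≡ window s a m ++ window s (m + a) n
window-++ s a zero    n = refl
window-++ s a (suc m) n = cong (s a ∷_) (begin
  window s (suc a) (m + n)                       ≡⟨ window-++ s (suc a) m n ⟩
  window s (suc a) m ++ window s (m + suc a) n   ≡⟨ cong (λ x → window s (suc a) m ++ window s x n) (+-suc m a) ⟩
  window s (suc a) m ++ window s (suc (m + a)) n ∎)
  where open ≡-Reasoning

endsWith-window : ∀ s r m {c} p → m + length p ≡ c → window s (r + c) (length p) ≡ p →
                  EndsWith (window s (length p + r) c) p
endsWith-window s r m p refl occ = prefix , (begin
  window s a (m + length p)                         ≡⟨ window-++ s a m (length p) ⟩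
  prefix ++ window s (m + a) (length p)             ≡⟨ cong (λ x → prefix ++ window s x (length p)) position ⟩
  prefix ++ window s (r + (m + length p)) (length p) ≡⟨ cong (prefix ++_) occ ⟩
  prefix ++ p                                       ∎)
  where
    open ≡-Reasoning
    a = length p + r
    prefix = window s a m
    position : m + a ≡ r + (m + length p)
    position = trans (sym (+-assoc m (length p) r)) (+-comm (m + length p) r)

tabulate-window : ∀ {c} s a (u : Vector Bool c) → (∀ i → u i ≡ s (a + toℕ i)) → tabulate u ≡ window s a c
tabulate-window {zero}  s a u eq = refl
tabulate-window {suc c} s a u eq = cong₂ _∷_
  (trans (eq Fin.zero) (cong s (+-identityʳ a)))
  (tabulate-window s (suc a) (tail u) (λ i → trans (eq (Fin.suc i)) (cong s (+-suc a (toℕ i)))))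

extend : ∀ {N} {A : Set} → A → Vector A N → ℕ → A
extend {zero}  d u k       = d
extend {suc N} d u zero    = u Fin.zero
extend {suc N} d u (suc k) = extend d (tail u) k

extend-toℕ : ∀ {N} {A : Set} (d : A) (u : Vector A N) i → extend d u (toℕ i) ≡ u i
extend-toℕ d u Fin.zero    = refl
extend-toℕ d u (Fin.suc i) = extend-toℕ d (tail u) i

binRep-shift : ∀ {N c} (u : Vector Bool N) a (le : a + c ≤ N) →
               binRep (u ∘ shift a le) ≡ window (extend false u) a c
binRep-shift u a le = tabulate-window (extend false u) a (u ∘ shift a le) λ i →
  trans (sym (extend-toℕ false u (shift a le i))) (cong (extend false u) (toℕ-shift a le i))

[001] [011] [0101] : List Bool
[001]  = false ∷ false ∷ true ∷ []
[011]  = false ∷ true ∷ true ∷ []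
[0101] = false ∷ true ∷ false ∷ true ∷ []

Good : List Bool → Set
Good w = All (_≡ false) w ⊎ All (_≡ true) w ⊎ EndsWith w [001] ⊎ EndsWith w [011] ⊎ EndsWith w [0101]

ZeroPairAt : (ℕ → Bool) → ℕ → Set
ZeroPairAt s j = s j ≡ false × s (suc j) ≡ false

all-true-or-false : ∀ s a m → All (_≡ true) (window s a m) ⊎ ∃ λ k → k < m × s (k + a) ≡ false
all-true-or-false s a zero = inj₁ []
all-true-or-false s a (suc m) with s a in sa
... | false = inj₂ (0 , s≤s z≤n , sa)
... | true with all-true-or-false s (suc a) m
...   | inj₁ ones          = inj₁ (refl ∷ ones)
...   | inj₂ (k , k<m , z) = inj₂ (suc k , s≤s k<m , trans (cong s (sym (+-suc k a))) z)

zeros-or-001 : ∀ s j → ZeroPairAt s j → ∀ m →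
               All (_≡ false) (window s j m) ⊎ ∃ λ k → k < m × window s (k + j) 3 ≡ [001]
zeros-or-001 s j (z₀ , z₁) zero = inj₁ []
zeros-or-001 s j (z₀ , z₁) (suc m) with s (2 + j) in z₂
... | true  = inj₂ (0 , s≤s z≤n , cong₂ _∷_ z₀ (cong₂ _∷_ z₁ (cong (_∷ []) z₂)))
... | false with zeros-or-001 s (suc j) (z₁ , z₂) m
...   | inj₁ zeros           = inj₁ (z₀ ∷ zeros)
...   | inj₂ (k , k<m , occ) =
        inj₂ (suc k , s≤s k<m , subst (λ x → window s x 3 ≡ [001]) (+-suc k j) occ)

after-zero : ∀ s i → s i ≡ false →
             window s i 3 ≡ [011] ⊎ window s i 4 ≡ [0101] ⊎
             ZeroPairAt s i ⊎ ZeroPairAt s (2 + i)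
after-zero s i z with s (1 + i) | s (2 + i) | s (3 + i)
... | false | _     | _     = inj₂ (inj₂ (inj₁ (z , refl)))
... | true  | true  | _     rewrite z = inj₁ refl
... | true  | false | true  rewrite z = inj₂ (inj₁ refl)
... | true  | false | false = inj₂ (inj₂ (inj₂ (refl , refl)))

module LongWindow (s : ℕ → Bool) (d : ℕ) where

  c : ℕ
  c = 4 + d

  GoodWindow : Set
  GoodWindow = ∃ λ a → a + c ≤ 4 * c × Good (window s a c)

  goodWindow : ∀ a → a ≤ 3 + c + c → Good (window s a c) → GoodWindow
  goodWindow a a≤ good = a , ≤-trans (+-monoˡ-≤ c a≤) 3+3c≤4c , good
    where
      slack : ∀ d → 3 + (4 + d) + (4 + d) + (4 + d) + suc d ≡ 4 * (4 + d)
      slack = solve-∀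
      3+3c≤4c : 3 + c + c + c ≤ 4 * c
      3+3c≤4c = subst (3 + c + c + c ≤_) (slack d) (m≤m+n _ (suc d))

  from-zero-pair : ∀ r → r ≤ suc c → ZeroPairAt s (r + c) → GoodWindow
  from-zero-pair r r≤ pair with zeros-or-001 s (r + c) pair c
  ... | inj₁ zeros = goodWindow (r + c) (+-monoˡ-≤ c (≤-trans r≤ (m≤n+m (suc c) 2))) (inj₁ zeros)
  ... | inj₂ (k , k<c , occ) = goodWindow (3 + (k + r)) (+-monoʳ-≤ 3 k+r≤c+c)
        (inj₂ (inj₂ (inj₁ (endsWith-window s (k + r) (suc d) [001] (+-comm (suc d) 3)
          (subst (λ x → window s x 3 ≡ [001]) (sym (+-assoc k r c)) occ)))))
    where
      k+r≤c+c : k + r ≤ c + c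
      k+r≤c+c = s≤s⁻¹ (subst (k + r <_) (+-suc c c) (+-mono-<-≤ k<c r≤))

  goodWindow-exists : GoodWindow
  goodWindow-exists with all-true-or-false s c c
  ... | inj₁ ones = goodWindow c (≤-trans (m≤n+m c 3) (m≤m+n (3 + c) c)) (inj₂ (inj₁ ones))
  ... | inj₂ (k , k<c , z) with after-zero s (k + c) z
  ...   | inj₁ occ = goodWindow (3 + k) (+-monoʳ-≤ 3 (≤-trans (<⇒≤ k<c) (m≤m+n c c)))
          (inj₂ (inj₂ (inj₂ (inj₁ (endsWith-window s k (suc d) [011] (+-comm (suc d) 3) occ)))))
  ...   | inj₂ (inj₁ occ) = goodWindow (4 + k) (+-monoʳ-≤ 3 (≤-trans k<c (m≤m+n c c)))
          (inj₂ (inj₂ (inj₂ (inj₂ (endsWith-window s k d [0101] (+-comm d 4) occ)))))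
  ...   | inj₂ (inj₂ (inj₁ pair)) = from-zero-pair k (m≤n⇒m≤1+n (<⇒≤ k<c)) pair
  ...   | inj₂ (inj₂ (inj₂ pair)) = from-zero-pair (2 + k) (s≤s k<c) pair

good-pair : ∀ x → Good (x ∷ x ∷ [])
good-pair false = inj₁ (refl ∷ refl ∷ [])
good-pair true  = inj₂ (inj₁ (refl ∷ refl ∷ []))

good-triple : ∀ x y z → Good (false ∷ x ∷ y ∷ []) ⊎ Good (false ∷ y ∷ z ∷ [])
good-triple false false _     = inj₁ (inj₁ (refl ∷ refl ∷ refl ∷ []))
good-triple false true  _     = inj₁ (inj₂ (inj₂ (inj₁ ([] , refl))))
good-triple true  true  _     = inj₁ (inj₂ (inj₂ (inj₂ (inj₁ ([] , refl)))))
good-triple true  false false = inj₂ (inj₁ (refl ∷ refl ∷ refl ∷ []))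
good-triple true  false true  = inj₂ (inj₂ (inj₂ (inj₁ ([] , refl))))

good-retyped-window : ∀ s c → 1 ≤ c → ∃₂ λ a b → a + suc c ≤ 4 * suc c × Good (b ∷ window s (suc a) c)
good-retyped-window s 1 _ = 0 , s 1 , m≤m+n 2 6 , good-pair (s 1)
good-retyped-window s 2 _ with good-triple (s 1) (s 2) (s 3)
... | inj₁ good = 0 , false , m≤m+n 3 9 , good
... | inj₂ good = 1 , false , m≤m+n 4 8 , good
good-retyped-window s (suc (suc (suc d))) _ with LongWindow.goodWindow-exists s d
... | a , le , good = a , s a , le , good

Good-binRep : ∀ {c} (t : Vector Bool c) → Good (binRep t) →
              AllEq false t ⊎ AllEq true t ⊎
              EndsWith (binRep t) [001] ⊎ EndsWith (binRep t) [011] ⊎ EndsWith (binRep t) [0101]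
Good-binRep t (inj₁ zeros)       = inj₁ (tabulate⁻ zeros)
Good-binRep t (inj₂ (inj₁ ones)) = inj₂ (inj₁ (tabulate⁻ ones))
Good-binRep t (inj₂ (inj₂ ends)) = inj₂ (inj₂ ends)

lemma8 : (c : ℕ) → 2 ≤ c → (n : ℕ) → (G : Graph n) →
         (P : Fin (4 * c) → Fin n) → (tP : Fin (4 * c) → Bool) →
         IsChain G (4 * c) P tP →
         Σ (Fin c → Fin n) λ v → Σ (Fin c → Bool) λ t →
           IsChain G c v t ×
           (AllEq false t ⊎ AllEq true t ⊎
            EndsWith (binRep t) (false ∷ false ∷ true ∷ []) ⊎
            EndsWith (binRep t) (false ∷ true ∷ true ∷ []) ⊎
            EndsWith (binRep t) (false ∷ true ∷ false ∷ true ∷ []))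
lemma8 (suc c) (s≤s 1≤c) n G P tP chain with good-retyped-window (extend false tP) c 1≤c
... | a , b , le , good =
  P ∘ shift a le , t ,
  IsChain-retypeHead (IsChain-window chain a le) b ,
  Good-binRep t (subst Good (sym binRep-t) good)
  where
    t : Fin (suc c) → Bool
    t = b ◂ tail (tP ∘ shift a le)
    binRep-t : binRep t ≡ b ∷ window (extend false tP) (suc a) c
    binRep-t = cong (b ∷_) (∷-injectiveʳ (binRep-shift tP a le))
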